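{- If $G$ is a bipartite graph of order $n$, then $\nu(G)\ge n-a(G)$.
   Context: $\nu(G)$ is the matching number of $G$. For a graph $G$ with $m$ edges and vertex degrees sorted as $d_1\le d_2\le\dots\le d_n$, the annihilation number $a(G)$ is the largest index $a$ such that $\sum_{i=1}^{a} d_i\le m$. -}

module Defs where

open import Data.Nat using (ℕ; _≤_; _<ᵇ_)
open import Data.Nat.Properties using (≤-decTotalOrder)
open import Data.Bool using (Bool; true; false; if_then_else_; _∧_)
open import Data.Fin using (Fin; toℕ)
open import Data.Nat.ListAction using (sum)
open import Data.List using (List; []; _∷_; map; take; length; concatMap; allFin)
open import Data.List.Relation.Unary.All using (All)
open import Data.List.Relation.Unary.Unique.Propositional using (Unique)
open import Data.List.Sort.MergeSort ≤-decTotalOrder using (sort)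
open import Data.Product using (Σ; _×_; _,_; proj₁; proj₂)
open import Relation.Binary.PropositionalEquality using (_≡_; _≢_)

record Graph (n : ℕ) : Set where
  field
    adj    : Fin n → Fin n → Bool
    sym    : ∀ i j → adj i j ≡ adj j i
    irrefl : ∀ i → adj i i ≡ false
open Graph public

IsBipartite : ∀ {n} → Graph n → Set
IsBipartite {n} G = Σ (Fin n → Bool) λ c → ∀ i j → adj G i j ≡ true → c i ≢ c j

degree : ∀ {n} → Graph n → Fin n → ℕ
degree {n} G i = sum (map (λ j → if adj G i j then 1 else 0) (allFin n))

edgeCount : ∀ {n} → Graph n → ℕ
edgeCount {n} G =
  sum (map (λ i → sum (map (λ j → if (toℕ i <ᵇ toℕ j) ∧ adj G i j then 1 else 0)
                           (allFin n)))
           (allFin n))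

sortedDegrees : ∀ {n} → Graph n → List ℕ
sortedDegrees {n} G = sort (map (degree G) (allFin n))

IsAnnihilationNumber : ∀ {n} → Graph n → ℕ → Set
IsAnnihilationNumber {n} G a =
  (a ≤ n × sum (take a (sortedDegrees G)) ≤ edgeCount G)
  × (∀ b → b ≤ n → sum (take b (sortedDegrees G)) ≤ edgeCount G → b ≤ a)

IsMatching : ∀ {n} → Graph n → List (Fin n × Fin n) → Set
IsMatching G M =
  All (λ e → adj G (proj₁ e) (proj₂ e) ≡ true) M
  × Unique (concatMap (λ e → proj₁ e ∷ proj₂ e ∷ []) M)

-- König's theorem gives a matching M and a vertex cover C of the bipartite graph with
-- |C| = |M|. The vertices outside C form an independent set I; as every edge has at most one
-- end in I, the degrees of I sum to at most m, hence so do the |I| smallest degrees, and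
-- |I| ≤ a(G) by maximality of a(G). Thus ν(G) ≥ |M| = |C| = n − |I| ≥ n − a(G).
-- König's theorem is proved by augmenting paths: grow the set of vertices reached from the
-- free left vertices along alternating paths; if it contains a free right vertex, flip the
-- path to enlarge the matching, otherwise the reached right ends and the unreached left ends
-- of the matched edges cover every edge.

module Submission where

open import Defs renaming (sym to adj-sym)
open import Data.Nat using (ℕ; zero; suc; _+_; _*_; _≤_; _<_; _∸_; _<ᵇ_; z≤n; s≤s)
open import Data.Nat.Properties
open import Algebra.Properties.Semiring.Sum +-*-semiring
  using (sum-syntax; sum-cong-≗; sum-replicate-zero; ∑-distrib-+; ∑-comm; *-distribˡ-sum)
open import Data.Nat.ListAction using (sum)
open import Data.Nat.ListAction.Properties using (sum-↭)
open import Data.Bool using (Bool; true; false; if_then_else_; not; _∧_; _∨_)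
open import Data.Bool.Properties using (∧-zeroʳ; T-≡) renaming (_≟_ to _≟ᵇ_)
open import Function.Bundles using (Equivalence)
open import Data.Fin using (Fin; toℕ) renaming (zero to fzero; suc to fsuc)
import Data.Fin.Properties as Fin
open import Data.List using (List; []; _∷_; _++_; length; map; take; tabulate; allFin; concatMap)
open import Data.List.Properties using (map-tabulate; map-cong; ++-assoc; length-map; take-[])
open import Data.List.Membership.Propositional using (_∈_; _∉_; find; lose)
open import Data.List.Membership.Propositional.Properties
  using (∈-++⁻; ∈-++⁺ʳ; ∈-∃++; ∈-concatMap⁻; ∈-map⁺; ∈-allFin)
open import Data.List.Relation.Unary.Any using (here; there; any?)
import Data.List.Relation.Unary.All as All
open import Data.List.Relation.Unary.All.Properties using (All¬⇒¬Any; ¬Any⇒All¬)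
open import Data.List.Relation.Unary.AllPairs using ([]; _∷_)
open import Data.List.Relation.Unary.Unique.Propositional using (Unique)
open import Data.List.Relation.Unary.Unique.Propositional.Properties using (allFin⁺)
open import Data.List.Relation.Unary.Linked.Properties using (Linked⇒All)
open import Data.List.Relation.Unary.Sorted.TotalOrder ≤-totalOrder using (Sorted)
import Data.List.Relation.Unary.Linked as Linked
open import Data.List.Sort.MergeSort.Properties ≤-decTotalOrder using (sort-↭; sort-↗)
open import Data.List.Relation.Binary.Permutation.Propositional
  using (_↭_; ↭-refl; ↭-sym; ↭-trans; ↭-reflexive; prep)
open import Data.List.Relation.Binary.Permutation.Propositional.Properties
  using (shift; drop-mid; ∈-resp-↭; ↭-length)
open import Data.Sum using (_⊎_; inj₁; inj₂; swap)
open import Data.Product using (Σ; _×_; _,_; proj₁; proj₂; map₁)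
open import Data.Maybe using (Maybe; just; nothing)
open import Data.Maybe.Properties using (just-injective) renaming (≡-dec to ≡-decMaybe)
open import Function using (_∘_)
open import Relation.Nullary using (Dec; yes; no)
open import Relation.Binary using (tri<; tri≈; tri>)
open import Relation.Nullary.Decidable using (does; dec-true; dec-false; ¬?; _×-dec_)
open import Data.Empty using (⊥; ⊥-elim)
open import Relation.Binary.PropositionalEquality
  using (_≡_; _≢_; refl; sym; trans; cong; cong₂; subst; subst₂; module ≡-Reasoning)

𝟙 : Bool → ℕ
𝟙 b = if b then 1 else 0

𝟙≤1 : ∀ b → 𝟙 b ≤ 1
𝟙≤1 true  = ≤-refl
𝟙≤1 false = z≤n

∑-mono-≤ : ∀ {n} {f g : Fin n → ℕ} → (∀ i → f i ≤ g i) → ∑[ i < n ] f i ≤ ∑[ i < n ] g i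
∑-mono-≤ {zero}  f≤g = z≤n
∑-mono-≤ {suc n} f≤g = +-mono-≤ (f≤g fzero) (∑-mono-≤ (f≤g ∘ fsuc))

∑-const-1 : ∀ n → ∑[ i < n ] 1 ≡ n
∑-const-1 zero    = refl
∑-const-1 (suc n) = cong suc (∑-const-1 n)

∑-≤1⇒≤n : ∀ {n} {f : Fin n → ℕ} → (∀ i → f i ≤ 1) → ∑[ i < n ] f i ≤ n
∑-≤1⇒≤n {n} {f} f≤1 = subst (∑[ i < n ] f i ≤_) (∑-const-1 n) (∑-mono-≤ f≤1)

∑-suc-at : ∀ {n} (k : Fin n) {f g : Fin n → ℕ} →
           (∀ i → i ≢ k → g i ≡ f i) → g k ≡ suc (f k) →
           ∑[ i < n ] g i ≡ suc (∑[ i < n ] f i)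
∑-suc-at fzero    g≡f gk = cong₂ _+_ gk (sum-cong-≗ (λ i → g≡f (fsuc i) λ ()))
∑-suc-at (fsuc k) {f} g≡f gk =
  trans (cong₂ _+_ (g≡f fzero λ ()) (∑-suc-at k (λ i i≢k → g≡f (fsuc i) (i≢k ∘ Fin.suc-injective)) gk))
        (+-suc (f fzero) _)

∑∑-distrib-+ : ∀ {m n} (f g : Fin m → Fin n → ℕ) →
               ∑[ i < m ] ∑[ j < n ] (f i j + g i j) ≡ ∑[ i < m ] ∑[ j < n ] f i j + ∑[ i < m ] ∑[ j < n ] g i j
∑∑-distrib-+ {m} {n} f g =
  trans (sum-cong-≗ (λ i → ∑-distrib-+ (f i) (g i))) (∑-distrib-+ (λ i → ∑[ j < n ] f i j) (λ i → ∑[ j < n ] g i j))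

sum-map-allFin : ∀ n (f : Fin n → ℕ) → sum (map f (allFin n)) ≡ ∑[ i < n ] f i
sum-map-allFin n f = trans (cong sum (map-tabulate (λ i → i) f)) (sum-tabulate n f)
  where
  sum-tabulate : ∀ n (f : Fin n → ℕ) → sum (tabulate f) ≡ ∑[ i < n ] f i
  sum-tabulate zero    f = refl
  sum-tabulate (suc n) f = cong (f fzero +_) (sum-tabulate n (f ∘ fsuc))

sum-take-sorted≤ : ∀ {xs} → Sorted xs → ∀ P Q → xs ↭ P ++ Q → sum (take (length P) xs) ≤ sum P
sum-take-sorted≤ {[]}     _ P Q _ = subst (_≤ sum P) (cong sum (sym (take-[] (length P)))) z≤n
sum-take-sorted≤ {x ∷ xs} sorted P Q x∷xs↭ with ∈-++⁻ P (∈-resp-↭ x∷xs↭ (here refl))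
... | inj₁ x∈P with A , B , refl ← ∈-∃++ x∈P =
  subst₂ _≤_ (cong (λ k → sum (take k (x ∷ xs))) (sym (↭-length (shift x A B))))
             (sym (sum-↭ (shift x A B)))
             (+-monoʳ-≤ x (sum-take-sorted≤ (Linked.tail sorted) (A ++ B) Q xs↭))
  where
  xs↭ : xs ↭ (A ++ B) ++ Q
  xs↭ = ↭-trans (drop-mid [] A (↭-trans x∷xs↭ (↭-reflexive (++-assoc A (x ∷ B) Q))))
                (↭-reflexive (sym (++-assoc A B Q)))
sum-take-sorted≤ {x ∷ xs} sorted []      Q x∷xs↭ | inj₂ _ = z≤n
sum-take-sorted≤ {x ∷ xs} sorted (p ∷ P) Q x∷xs↭ | inj₂ x∈Q with A , B , refl ← ∈-∃++ x∈Q =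
  +-mono-≤ x≤p (sum-take-sorted≤ (Linked.tail sorted) P (p ∷ A ++ B) xs↭)
  where
  x≤p : x ≤ p
  x≤p = All.lookup (Linked⇒All ≤-trans ≤-refl sorted) (∈-resp-↭ (↭-sym x∷xs↭) (here refl))
  xs↭ : xs ↭ P ++ p ∷ A ++ B
  xs↭ = ↭-trans (drop-mid [] (p ∷ P ++ A) (↭-trans x∷xs↭ (↭-reflexive (sym (++-assoc (p ∷ P) A (x ∷ B))))))
          (↭-trans (↭-reflexive (cong (p ∷_) (++-assoc P A B))) (↭-sym (shift p P (A ++ B))))

restrict : ∀ {n} → (Fin n → Bool) → (Fin n → ℕ) → List ℕ
restrict {zero}  p f = []
restrict {suc n} p f with p fzero
... | true  = f fzero ∷ restrict (p ∘ fsuc) (f ∘ fsuc)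
... | false = restrict (p ∘ fsuc) (f ∘ fsuc)

tabulate-↭-restrict : ∀ {n} (p : Fin n → Bool) (f : Fin n → ℕ) →
                      tabulate f ↭ restrict p f ++ restrict (not ∘ p) f
tabulate-↭-restrict {zero}  p f = ↭-refl
tabulate-↭-restrict {suc n} p f with p fzero
... | true  = prep (f fzero) (tabulate-↭-restrict (p ∘ fsuc) (f ∘ fsuc))
... | false = ↭-trans (prep (f fzero) (tabulate-↭-restrict (p ∘ fsuc) (f ∘ fsuc)))
                      (↭-sym (shift (f fzero) (restrict (p ∘ fsuc) (f ∘ fsuc)) _))

length-restrict : ∀ {n} (p : Fin n → Bool) (f : Fin n → ℕ) →
                  length (restrict p f) ≡ ∑[ i < n ] 𝟙 (p i)
length-restrict {zero}  p f = refl
length-restrict {suc n} p f with p fzero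
... | true  = cong suc (length-restrict (p ∘ fsuc) (f ∘ fsuc))
... | false = length-restrict (p ∘ fsuc) (f ∘ fsuc)

sum-restrict : ∀ {n} (p : Fin n → Bool) (f : Fin n → ℕ) →
               sum (restrict p f) ≡ ∑[ i < n ] (𝟙 (p i) * f i)
sum-restrict {zero}  p f = refl
sum-restrict {suc n} p f with p fzero
... | true  = cong₂ _+_ (sym (+-identityʳ (f fzero))) (sum-restrict (p ∘ fsuc) (f ∘ fsuc))
... | false = sum-restrict (p ∘ fsuc) (f ∘ fsuc)

∣_∣ : ∀ {n} → (Fin n → Bool) → ℕ
∣_∣ {n} p = ∑[ i < n ] 𝟙 (p i)

∣p∣≤n : ∀ {n} (p : Fin n → Bool) → ∣ p ∣ ≤ n
∣p∣≤n p = ∑-≤1⇒≤n (𝟙≤1 ∘ p)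

∣p∣+∣not∘p∣≡n : ∀ {n} (p : Fin n → Bool) → ∣ p ∣ + ∣ not ∘ p ∣ ≡ n
∣p∣+∣not∘p∣≡n {n} p = begin
  ∣ p ∣ + ∣ not ∘ p ∣                   ≡⟨ ∑-distrib-+ (𝟙 ∘ p) (𝟙 ∘ not ∘ p) ⟨
  ∑[ i < n ] (𝟙 (p i) + 𝟙 (not (p i))) ≡⟨ sum-cong-≗ (𝟙+𝟙not ∘ p) ⟩
  ∑[ i < n ] 1                          ≡⟨ ∑-const-1 n ⟩
  n                                     ∎
  where
  open ≡-Reasoning
  𝟙+𝟙not : ∀ b → 𝟙 b + 𝟙 (not b) ≡ 1
  𝟙+𝟙not true  = refl
  𝟙+𝟙not false = refl

module Membership {n : ℕ} where
  open import Data.List.Membership.DecPropositional (Fin._≟_ {n}) using (_∈?_) public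

  _∈ᵇ_ : Fin n → List (Fin n) → Bool
  i ∈ᵇ xs = does (i ∈? xs)

  ∈⇒∈ᵇ : ∀ {i xs} → i ∈ xs → i ∈ᵇ xs ≡ true
  ∈⇒∈ᵇ {i} {xs} = dec-true (i ∈? xs)

  ∉⇒∈ᵇ : ∀ {i xs} → i ∉ xs → i ∈ᵇ xs ≡ false
  ∉⇒∈ᵇ {i} {xs} = dec-false (i ∈? xs)

  ∣∈ᵇ-∷∣-∈ : ∀ {x xs} → x ∈ xs → ∣ _∈ᵇ (x ∷ xs) ∣ ≡ ∣ _∈ᵇ xs ∣
  ∣∈ᵇ-∷∣-∈ {x} {xs} x∈xs = sum-cong-≗ (cong 𝟙 ∘ pointwise)
    where
    pointwise : ∀ i → i ∈ᵇ (x ∷ xs) ≡ i ∈ᵇ xs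
    pointwise i with i Fin.≟ x
    ... | yes refl = sym (∈⇒∈ᵇ x∈xs)
    ... | no  _    = refl

  ∣∈ᵇ-∷∣-∉ : ∀ {x xs} → x ∉ xs → ∣ _∈ᵇ (x ∷ xs) ∣ ≡ suc ∣ _∈ᵇ xs ∣
  ∣∈ᵇ-∷∣-∉ {x} {xs} x∉xs = ∑-suc-at x (λ i i≢x → cong 𝟙 (elsewhere i≢x)) at-x
    where
    elsewhere : ∀ {i} → i ≢ x → i ∈ᵇ (x ∷ xs) ≡ i ∈ᵇ xs
    elsewhere {i} i≢x = cong (_∨ i ∈ᵇ xs) (dec-false (i Fin.≟ x) i≢x)
    at-x : 𝟙 (x ∈ᵇ (x ∷ xs)) ≡ suc (𝟙 (x ∈ᵇ xs))
    at-x rewrite dec-true (x Fin.≟ x) refl | ∉⇒∈ᵇ x∉xs = refl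

  ∣∈ᵇ∣≤length : ∀ xs → ∣ _∈ᵇ xs ∣ ≤ length xs
  ∣∈ᵇ∣≤length []       = ≤-reflexive (sum-replicate-zero n)
  ∣∈ᵇ∣≤length (x ∷ xs) with x ∈? xs
  ... | yes x∈xs = subst (_≤ suc (length xs)) (sym (∣∈ᵇ-∷∣-∈ x∈xs)) (m≤n⇒m≤1+n (∣∈ᵇ∣≤length xs))
  ... | no  x∉xs = subst (_≤ suc (length xs)) (sym (∣∈ᵇ-∷∣-∉ x∉xs)) (s≤s (∣∈ᵇ∣≤length xs))

  Unique⇒length≤n : ∀ {xs} → Unique xs → length xs ≤ n
  Unique⇒length≤n {xs} unique = subst (_≤ n) (sym (length≡∣∈ᵇ∣ unique)) (∣p∣≤n (_∈ᵇ xs))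
    where
    length≡∣∈ᵇ∣ : ∀ {xs} → Unique xs → length xs ≡ ∣ _∈ᵇ xs ∣
    length≡∣∈ᵇ∣ []                = sym (sum-replicate-zero n)
    length≡∣∈ᵇ∣ (x≢xs ∷ unique) =
      trans (cong suc (length≡∣∈ᵇ∣ unique)) (sym (∣∈ᵇ-∷∣-∉ (All¬⇒¬Any x≢xs)))

open Membership

module _ {n : ℕ} (G : Graph n) where

  IsIndependent : (Fin n → Bool) → Set
  IsIndependent I = ∀ {i j} → adj G i j ≡ true → I i ≡ true → I j ≡ true → ⊥

  IsVertexCover : List (Fin n) → Set
  IsVertexCover C = ∀ {i j} → adj G i j ≡ true → i ∈ C ⊎ j ∈ C

  edge< : Fin n → Fin n → ℕ
  edge< i j = 𝟙 ((toℕ i <ᵇ toℕ j) ∧ adj G i j)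

  degree≡∑ : ∀ i → degree G i ≡ ∑[ j < n ] 𝟙 (adj G i j)
  degree≡∑ i = sum-map-allFin n (𝟙 ∘ adj G i)

  edgeCount≡∑∑ : edgeCount G ≡ ∑[ i < n ] ∑[ j < n ] edge< i j
  edgeCount≡∑∑ = trans (cong sum (map-cong (λ i → sum-map-allFin n (edge< i)) (allFin n)))
                       (sum-map-allFin n (λ i → ∑[ j < n ] edge< i j))

  𝟙-adj≤edge< : ∀ i j → 𝟙 (adj G i j) ≤ edge< i j + edge< j i
  𝟙-adj≤edge< i j with adj G i j in i~j
  ... | false = z≤n
  ... | true with Fin.<-cmp i j
  ...   | tri< i<j _ _ rewrite Equivalence.to T-≡ (<⇒<ᵇ i<j) = s≤s z≤n
  ...   | tri> _ _ j<i rewrite Equivalence.to T-≡ (<⇒<ᵇ j<i) | adj-sym G j i | i~j = m≤n+m 1 _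
  ...   | tri≈ _ refl _ with () ← trans (sym i~j) (irrefl G i)

  edge<-independent : ∀ {I} → IsIndependent I → ∀ i j → 𝟙 (I i) * edge< i j + 𝟙 (I j) * edge< i j ≤ edge< i j
  edge<-independent {I} indep i j with I i in Ii | I j in Ij
  ... | false | false = z≤n
  ... | true  | false = ≤-reflexive (trans (+-identityʳ _) (+-identityʳ _))
  ... | false | true  = ≤-reflexive (+-identityʳ _)
  ... | true  | true with adj G i j in i~j
  ...   | true  = ⊥-elim (indep i~j Ii Ij)
  ...   | false rewrite ∧-zeroʳ (toℕ i <ᵇ toℕ j) = z≤n

  ∑-degree-independent≤edgeCount : ∀ {I} → IsIndependent I → ∑[ i < n ] (𝟙 (I i) * degree G i) ≤ edgeCount G
  ∑-degree-independent≤edgeCount {I} indep = begin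
    ∑[ i < n ] (𝟙 (I i) * degree G i)
      ≡⟨ sum-cong-≗ (λ i → trans (cong (𝟙 (I i) *_) (degree≡∑ i)) (*-distribˡ-sum (𝟙 (I i)) (𝟙 ∘ adj G i))) ⟩
    ∑[ i < n ] ∑[ j < n ] (𝟙 (I i) * 𝟙 (adj G i j))
      ≤⟨ ∑-mono-≤ (λ i → ∑-mono-≤ (λ j → *-monoʳ-≤ (𝟙 (I i)) (𝟙-adj≤edge< i j))) ⟩
    ∑[ i < n ] ∑[ j < n ] (𝟙 (I i) * (edge< i j + edge< j i))
      ≡⟨ sum-cong-≗ (λ i → sum-cong-≗ (λ j → *-distribˡ-+ (𝟙 (I i)) (edge< i j) (edge< j i))) ⟩
    ∑[ i < n ] ∑[ j < n ] (left i j + right j i)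
      ≡⟨ ∑∑-distrib-+ left (λ i j → right j i) ⟩
    ∑[ i < n ] ∑[ j < n ] left i j + ∑[ i < n ] ∑[ j < n ] right j i
      ≡⟨ cong (∑[ i < n ] ∑[ j < n ] left i j +_) (∑-comm (λ i j → right j i)) ⟩
    ∑[ i < n ] ∑[ j < n ] left i j + ∑[ i < n ] ∑[ j < n ] right i j
      ≡⟨ ∑∑-distrib-+ left right ⟨
    ∑[ i < n ] ∑[ j < n ] (left i j + right i j)
      ≤⟨ ∑-mono-≤ (λ i → ∑-mono-≤ (edge<-independent indep i)) ⟩
    ∑[ i < n ] ∑[ j < n ] edge< i j
      ≡⟨ edgeCount≡∑∑ ⟨
    edgeCount G ∎
    where
    open ≤-Reasoning
    left right : Fin n → Fin n → ℕ
    left  i j = 𝟙 (I i) * edge< i j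
    right i j = 𝟙 (I j) * edge< i j

  independent≤annihilation : ∀ {I a} → IsIndependent I → IsAnnihilationNumber G a → ∣ I ∣ ≤ a
  independent≤annihilation {I} indep (_ , maximal) = maximal ∣ I ∣ (∣p∣≤n I) (begin
    sum (take ∣ I ∣ (sortedDegrees G))
      ≡⟨ cong (λ k → sum (take k (sortedDegrees G))) (length-restrict I (degree G)) ⟨
    sum (take (length (restrict I (degree G))) (sortedDegrees G))
      ≤⟨ sum-take-sorted≤ (sort-↗ (map (degree G) (allFin n))) (restrict I (degree G)) _ degrees↭ ⟩
    sum (restrict I (degree G))
      ≡⟨ sum-restrict I (degree G) ⟩
    ∑[ i < n ] (𝟙 (I i) * degree G i)
      ≤⟨ ∑-degree-independent≤edgeCount indep ⟩
    edgeCount G ∎)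
    where
    open ≤-Reasoning
    degrees↭ : sortedDegrees G ↭ restrict I (degree G) ++ restrict (not ∘ I) (degree G)
    degrees↭ = ↭-trans (sort-↭ _) (↭-trans (↭-reflexive (map-tabulate (λ i → i) (degree G)))
                                            (tabulate-↭-restrict I (degree G)))

  n∸a≤vertexCover : ∀ {a C} → IsAnnihilationNumber G a → IsVertexCover C → n ∸ a ≤ length C
  n∸a≤vertexCover {a} {C} ann cover = begin
    n ∸ a                                    ≤⟨ ∸-monoʳ-≤ n (independent≤annihilation uncovered-independent ann) ⟩
    n ∸ ∣ uncovered ∣                        ≡⟨ cong (_∸ ∣ uncovered ∣) (∣p∣+∣not∘p∣≡n (_∈ᵇ C)) ⟨
    ∣ _∈ᵇ C ∣ + ∣ uncovered ∣ ∸ ∣ uncovered ∣ ≡⟨ m+n∸n≡m ∣ _∈ᵇ C ∣ ∣ uncovered ∣ ⟩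
    ∣ _∈ᵇ C ∣                                ≤⟨ ∣∈ᵇ∣≤length C ⟩
    length C                                 ∎
    where
    open ≤-Reasoning
    uncovered : Fin n → Bool
    uncovered = not ∘ (_∈ᵇ C)
    uncovered-independent : IsIndependent uncovered
    uncovered-independent i~j i∉C j∉C with cover i~j
    ... | inj₁ i∈C rewrite ∈⇒∈ᵇ i∈C with () ← i∉C
    ... | inj₂ j∈C rewrite ∈⇒∈ᵇ j∈C with () ← j∉C

module König {n : ℕ} (G : Graph n) (side : Fin n → Bool)
             (proper : ∀ i j → adj G i j ≡ true → side i ≢ side j) where

  _~_ : Fin n → Fin n → Set
  i ~ j = adj G i j ≡ true

  ~-sym : ∀ {i j} → i ~ j → j ~ i
  ~-sym {i} {j} i~j = trans (adj-sym G j i) i~j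

  Left Right : Fin n → Set
  Left  x = side x ≡ false
  Right x = side x ≡ true

  left-~ : ∀ {i j} → Left i → i ~ j → Right j
  left-~ {i} {j} left-i i~j with side j in side-j
  ... | true  = refl
  ... | false = ⊥-elim (proper i j i~j (trans left-i (sym side-j)))

  right-~ : ∀ {i j} → Right i → i ~ j → Left j
  right-~ {i} {j} right-i i~j with side j in side-j
  ... | false = refl
  ... | true  = ⊥-elim (proper i j i~j (trans right-i (sym side-j)))

  left≢right : ∀ {x y} → Left x → Right y → x ≢ y
  left≢right left-x right-y refl with () ← trans (sym left-x) right-y

  record Mates : Set where
    field
      mate     : Fin n → Maybe (Fin n)
      mate-sym : ∀ {x y} → mate x ≡ just y → mate y ≡ just x
      mate-~   : ∀ {x y} → mate x ≡ just y → x ~ y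
  open Mates

  mate-injective : ∀ M {x y z} → mate M x ≡ just z → mate M y ≡ just z → x ≡ y
  mate-injective M x↦z y↦z = just-injective (trans (sym (mate-sym M x↦z)) (mate-sym M y↦z))

  unmatched : Mates
  unmatched = record { mate = λ _ → nothing ; mate-sym = λ () ; mate-~ = λ () }

  -- a matching is listed by the edges at its left ends
  edgeAt : Bool → Maybe (Fin n) → Fin n → List (Fin n × Fin n)
  edgeAt true  _        x = []
  edgeAt false nothing  x = []
  edgeAt false (just y) x = (x , y) ∷ []

  matchedAt : Mates → Fin n → List (Fin n × Fin n)
  matchedAt M x = edgeAt (side x) (mate M x) x

  size : Mates → ℕ
  size M = ∑[ x < n ] length (matchedAt M x)

  length-matchedAt≤1 : ∀ M x → length (matchedAt M x) ≤ 1
  length-matchedAt≤1 M x with side x | mate M x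
  ... | true  | _       = z≤n
  ... | false | nothing = z≤n
  ... | false | just _  = ≤-refl

  length-matchedAt-right : ∀ M {x} → Right x → length (matchedAt M x) ≡ 0
  length-matchedAt-right M right-x rewrite right-x = refl

  length-matchedAt-free : ∀ M {x} → mate M x ≡ nothing → length (matchedAt M x) ≡ 0
  length-matchedAt-free M {x} free-x rewrite free-x with side x
  ... | true  = refl
  ... | false = refl

  length-matchedAt-matched : ∀ M {x y} → Left x → mate M x ≡ just y → length (matchedAt M x) ≡ 1
  length-matchedAt-matched M left-x x↦y rewrite left-x | x↦y = refl

  length-matchedAt-cong : ∀ M M′ {x} → mate M′ x ≡ mate M x → length (matchedAt M′ x) ≡ length (matchedAt M x)
  length-matchedAt-cong M M′ {x} eq = cong (λ m → length (edgeAt (side x) m x)) eq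

  size≤n : ∀ M → size M ≤ n
  size≤n M = ∑-≤1⇒≤n (length-matchedAt≤1 M)

  -- Match l to the free vertex r, releasing the former mate of l if there is one.
  module Rematch (M : Mates) {l r : Fin n} (left-l : Left l) (l~r : l ~ r) (free-r : mate M r ≡ nothing) where

    right-r : Right r
    right-r = left-~ left-l l~r

    r≢l : r ≢ l
    r≢l r≡l = left≢right left-l right-r (sym r≡l)

    mate′ : Fin n → Maybe (Fin n)
    mate′ x with x Fin.≟ l | x Fin.≟ r | ≡-decMaybe Fin._≟_ (mate M x) (just l)
    ... | yes _ | _     | _     = just r
    ... | no  _ | yes _ | _     = just l
    ... | no  _ | no  _ | yes _ = nothing
    ... | no  _ | no  _ | no  _ = mate M x

    mate′-l : mate′ l ≡ just r
    mate′-l with l Fin.≟ l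
    ... | yes _   = refl
    ... | no  l≢l = ⊥-elim (l≢l refl)

    mate′-r : mate′ r ≡ just l
    mate′-r with r Fin.≟ l | r Fin.≟ r
    ... | yes r≡l | _       = ⊥-elim (r≢l r≡l)
    ... | no  _   | yes _   = refl
    ... | no  _   | no  r≢r = ⊥-elim (r≢r refl)

    mate′-released : ∀ {x} → mate M x ≡ just l → mate′ x ≡ nothing
    mate′-released {x} x↦l with x Fin.≟ l | x Fin.≟ r | ≡-decMaybe Fin._≟_ (mate M x) (just l)
    ... | yes refl | _        | _     with () ← trans (sym (mate-~ M x↦l)) (irrefl G _)
    ... | no  _    | yes refl | _     with () ← trans (sym free-r) x↦l
    ... | no  _    | no  _    | yes _ = refl
    ... | no  _    | no  _    | no  ¬x↦l = ⊥-elim (¬x↦l x↦l)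

    mate′-other : ∀ {x} → x ≢ l → x ≢ r → mate M x ≢ just l → mate′ x ≡ mate M x
    mate′-other {x} x≢l x≢r ¬x↦l with x Fin.≟ l | x Fin.≟ r | ≡-decMaybe Fin._≟_ (mate M x) (just l)
    ... | yes x≡l | _       | _       = ⊥-elim (x≢l x≡l)
    ... | no  _   | yes x≡r | _       = ⊥-elim (x≢r x≡r)
    ... | no  _   | no  _   | yes x↦l = ⊥-elim (¬x↦l x↦l)
    ... | no  _   | no  _   | no  _   = refl

    mate′-sym : ∀ {x y} → mate′ x ≡ just y → mate′ y ≡ just x
    mate′-sym {x} {y} x↦y with x Fin.≟ l | x Fin.≟ r | ≡-decMaybe Fin._≟_ (mate M x) (just l)
    ... | yes refl | _        | _ with refl ← x↦y = mate′-r
    ... | no  _    | yes refl | _ with refl ← x↦y = mate′-l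
    ... | no  _    | no  _    | yes _ with () ← x↦y
    ... | no  x≢l  | no  x≢r  | no  ¬x↦l = trans (mate′-other y≢l y≢r y↦x≢l) y↦x
      where
      y↦x : mate M y ≡ just x
      y↦x = mate-sym M x↦y
      y≢l : y ≢ l
      y≢l refl = ¬x↦l x↦y
      y≢r : y ≢ r
      y≢r refl with () ← trans (sym free-r) y↦x
      y↦x≢l : mate M y ≢ just l
      y↦x≢l y↦l = x≢l (just-injective (trans (sym y↦x) y↦l))

    mate′-~ : ∀ {x y} → mate′ x ≡ just y → x ~ y
    mate′-~ {x} {y} x↦y with x Fin.≟ l | x Fin.≟ r | ≡-decMaybe Fin._≟_ (mate M x) (just l)
    ... | yes refl | _        | _ with refl ← x↦y = l~r
    ... | no  _    | yes refl | _ with refl ← x↦y = ~-sym l~r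
    ... | no  _    | no  _    | yes _ with () ← x↦y
    ... | no  _    | no  _    | no  _ = mate-~ M x↦y

    M′ : Mates
    M′ = record { mate = mate′ ; mate-sym = mate′-sym ; mate-~ = mate′-~ }

    length-matchedAt′ : ∀ {x} → x ≢ l → length (matchedAt M′ x) ≡ length (matchedAt M x)
    length-matchedAt′ {x} x≢l = by-cases (x Fin.≟ r) (≡-decMaybe Fin._≟_ (mate M x) (just l))
      where
      unchanged-at-right : Right x → length (matchedAt M′ x) ≡ length (matchedAt M x)
      unchanged-at-right right-x = trans (length-matchedAt-right M′ right-x) (sym (length-matchedAt-right M right-x))
      by-cases : Dec (x ≡ r) → Dec (mate M x ≡ just l) → length (matchedAt M′ x) ≡ length (matchedAt M x)
      by-cases (yes refl) _          = unchanged-at-right right-r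
      by-cases (no  _)    (yes x↦l) = unchanged-at-right (left-~ left-l (~-sym (mate-~ M x↦l)))
      by-cases (no  x≢r)  (no ¬x↦l) = length-matchedAt-cong M M′ (mate′-other x≢l x≢r ¬x↦l)

    size-M′-free : mate M l ≡ nothing → size M′ ≡ suc (size M)
    size-M′-free free-l = ∑-suc-at l (λ x → length-matchedAt′)
      (trans (length-matchedAt-matched M′ left-l mate′-l) (cong suc (sym (length-matchedAt-free M free-l))))

    size-M′-matched : ∀ {r′} → mate M l ≡ just r′ → size M′ ≡ size M
    size-M′-matched l↦r′ = sum-cong-≗ λ x → by-cases (x Fin.≟ l)
      where
      by-cases : ∀ {x} → Dec (x ≡ l) → length (matchedAt M′ x) ≡ length (matchedAt M x)
      by-cases (yes refl) = trans (length-matchedAt-matched M′ left-l mate′-l) (sym (length-matchedAt-matched M left-l l↦r′))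
      by-cases (no  x≢l)  = length-matchedAt′ x≢l

  -- zs grows, newest first, along alternating paths from the free left vertices:
  -- every entry is reached by one step from the entries after it.
  data Next (M : Mates) (zs : List (Fin n)) (x : Fin n) : Set where
    free     : Left x → mate M x ≡ nothing → Next M zs x
    via-edge : ∀ {l} → l ∈ zs → Left l → l ~ x → Next M zs x
    via-mate : ∀ {r} → r ∈ zs → Right r → mate M r ≡ just x → Next M zs x

  data Explored (M : Mates) : List (Fin n) → Set where
    []     : Explored M []
    extend : ∀ {x xs} → x ∉ xs → Next M xs x → Explored M xs → Explored M (x ∷ xs)

  Explored⇒Unique : ∀ {M zs} → Explored M zs → Unique zs
  Explored⇒Unique []                 = []
  Explored⇒Unique (extend x∉xs _ ex) = ¬Any⇒All¬ _ x∉xs ∷ Explored⇒Unique ex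

  Next-right : ∀ {M M′ zs x} → Right x → Next M zs x → Next M′ zs x
  Next-right right-x (free left-x _)             = ⊥-elim (left≢right left-x right-x refl)
  Next-right right-x (via-edge l∈zs left-l l~x)  = via-edge l∈zs left-l l~x
  Next-right {M} right-x (via-mate _ right-r r↦x) =
    ⊥-elim (left≢right (right-~ right-r (mate-~ M r↦x)) right-x refl)

  Agree : Mates → Mates → List (Fin n) → Set
  Agree M M′ zs = ∀ {z} → z ∈ zs → mate M′ z ≡ mate M z

  Explored-transport : ∀ {M M′ zs} → Agree M M′ zs → Explored M zs → Explored M′ zs
  Explored-transport agree [] = []
  Explored-transport {M} {M′} agree (extend {x} {xs} x∉xs next ex) =
    extend x∉xs (Next-transport next) (Explored-transport (agree ∘ there) ex)
    where
    Next-transport : Next M xs x → Next M′ xs x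
    Next-transport (free left-x free-x)        = free left-x (trans (agree (here refl)) free-x)
    Next-transport (via-edge l∈xs left-l l~x)  = via-edge l∈xs left-l l~x
    Next-transport (via-mate r∈xs right-r r↦x) = via-mate r∈xs right-r (trans (agree (there r∈xs)) r↦x)

  record Before (M : Mates) (zs : List (Fin n)) (y : Fin n) : Set where
    field
      earlier   : List (Fin n)
      y∉earlier : y ∉ earlier
      next      : Next M earlier y
      explored  : Explored M earlier
      ⊆zs       : ∀ {z} → z ∈ earlier → z ∈ zs
      shorter   : length earlier < length zs
  open Before

  before : ∀ {M zs y} → Explored M zs → y ∈ zs → Before M zs y
  before (extend y∉xs next ex) (here refl) = record
    { earlier = _ ; y∉earlier = y∉xs ; next = next ; explored = ex ; ⊆zs = there ; shorter = ≤-refl }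
  before (extend _ _ ex) (there y∈xs) = record
    { earlier = earlier b ; y∉earlier = y∉earlier b ; next = next b ; explored = explored b
    ; ⊆zs = there ∘ ⊆zs b ; shorter = m≤n⇒m≤1+n (shorter b) }
    where b = before ex y∈xs

  Before-transport : ∀ {M M′ zs y} → Right y → (b : Before M zs y) → Agree M M′ (earlier b) → Before M′ zs y
  Before-transport right-y b agree = record
    { earlier = earlier b ; y∉earlier = y∉earlier b ; next = Next-right right-y (next b)
    ; explored = Explored-transport agree (explored b) ; ⊆zs = ⊆zs b ; shorter = shorter b }

  -- Follow the alternating path back from the free right vertex x, rematching each left
  -- vertex on it with its successor; the path starts at a free left vertex, so M grows by one.
  augment : ∀ k M {zs x} (bx : Before M zs x) → length (earlier bx) < k →
            Right x → mate M x ≡ nothing → Σ Mates λ M″ → size M″ ≡ suc (size M)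
  augment (suc k) M {x = x} bx fuel right-x free-x with next bx
  ... | free left-x _ = ⊥-elim (left≢right left-x right-x refl)
  ... | via-mate _ right-r r↦x = ⊥-elim (left≢right (right-~ right-r (mate-~ M r↦x)) right-x refl)
  ... | via-edge {l} l∈ left-l l~x = from-l (next bl)
    where
    bl = before (explored bx) l∈
    open Rematch M left-l l~x free-x
    from-l : Next M (earlier bl) l → Σ Mates λ M″ → size M″ ≡ suc (size M)
    from-l (free _ free-l)            = M′ , size-M′-free free-l
    from-l (via-edge _ left-l′ l′~l)  = ⊥-elim (left≢right left-l (left-~ left-l′ l′~l) refl)
    from-l (via-mate {r′} r′∈ right-r′ r′↦l) =
      proj₁ rest , trans (proj₂ rest) (cong suc (size-M′-matched (mate-sym M r′↦l)))
      where
      br′ = before (explored bl) r′∈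
      agree : Agree M M′ (earlier br′)
      agree {z} z∈ = mate′-other z≢l z≢x ¬z↦l
        where
        z≢l : z ≢ l
        z≢l refl = y∉earlier bl (⊆zs br′ z∈)
        z≢x : z ≢ x
        z≢x refl = y∉earlier bx (⊆zs bl (⊆zs br′ z∈))
        ¬z↦l : mate M z ≢ just l
        ¬z↦l z↦l = y∉earlier br′ (subst (_∈ earlier br′) (mate-injective M z↦l r′↦l) z∈)
      fuel′ : length (earlier br′) < k
      fuel′ = <-trans (shorter br′) (<-≤-trans (shorter bl) (≤-pred fuel))
      rest = augment k M′ (Before-transport right-r′ br′ agree) fuel′ right-r′ (mate′-released r′↦l)

  Closed : Mates → List (Fin n) → Set
  Closed M zs = ∀ {x} → Next M zs x → x ∈ zs

  next? : ∀ M zs x → Dec (Next M zs x)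
  next? M zs x with (side x ≟ᵇ false) ×-dec (≡-decMaybe Fin._≟_ (mate M x) nothing)
  ... | yes (left-x , free-x) = yes (free left-x free-x)
  ... | no ¬free with any? (λ l → (side l ≟ᵇ false) ×-dec (adj G l x ≟ᵇ true)) zs
  ...   | yes some = let l , l∈ , left-l , l~x = find some in yes (via-edge l∈ left-l l~x)
  ...   | no ¬edge with any? (λ r → (side r ≟ᵇ true) ×-dec (≡-decMaybe Fin._≟_ (mate M r) (just x))) zs
  ...     | yes some = let r , r∈ , right-r , r↦x = find some in yes (via-mate r∈ right-r r↦x)
  ...     | no ¬mate = no λ where
    (free left-x free-x)        → ¬free (left-x , free-x)
    (via-edge l∈ left-l l~x)    → ¬edge (lose l∈ (left-l , l~x))
    (via-mate r∈ right-r r↦x)   → ¬mate (lose r∈ (right-r , r↦x))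

  explore : ∀ k M {zs} → Explored M zs → n ≤ length zs + k →
            Σ (List (Fin n)) λ zs′ → Explored M zs′ × Closed M zs′
  explore k M {zs} ex n≤ with Fin.any? (λ x → ¬? (x ∈? zs) ×-dec next? M zs x)
  ... | no none = zs , ex , closed
    where
    closed : Closed M zs
    closed {x} nx with x ∈? zs
    ... | yes x∈zs = x∈zs
    ... | no  x∉zs = ⊥-elim (none (x , x∉zs , nx))
  ... | yes (x , x∉zs , nx) with k
  ...   | zero  = ⊥-elim (<⇒≱ (Unique⇒length≤n (Explored⇒Unique ex′)) (subst (n ≤_) (+-identityʳ _) n≤))
    where ex′ = extend x∉zs nx ex
  ...   | suc k = explore k M (extend x∉zs nx ex) (subst (n ≤_) (+-suc _ k) n≤)

  record Saturated (M : Mates) : Set where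
    field
      reached         : List (Fin n)
      reached-closed  : Closed M reached
      reached-matched : ∀ {r} → r ∈ reached → Right r → mate M r ≢ nothing

  saturate : ∀ k M → n ≤ size M + k → Σ Mates Saturated
  saturate k M n≤ with zs , ex , closed ← explore n M [] ≤-refl
    with any? (λ r → (side r ≟ᵇ true) ×-dec (≡-decMaybe Fin._≟_ (mate M r) nothing)) zs
  ... | no none = M , record
    { reached = zs ; reached-closed = closed
    ; reached-matched = λ r∈ right-r free-r → none (lose r∈ (right-r , free-r)) }
  ... | yes some with r , r∈ , right-r , free-r ← find some
    with M′ , size′ ← augment _ M (before ex r∈) ≤-refl right-r free-r
    with k
  ...   | zero  = ⊥-elim (<⇒≱ (subst (_≤ n) size′ (size≤n M′)) (subst (n ≤_) (+-identityʳ _) n≤))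
  ...   | suc k = saturate k M′ (subst (n ≤_) (trans (+-suc _ k) (cong (_+ k) (sym size′))) n≤)

  endpoints : List (Fin n × Fin n) → List (Fin n)
  endpoints = concatMap (λ e → proj₁ e ∷ proj₂ e ∷ [])

  ∈-endpoints⁻ : ∀ {z es} → z ∈ endpoints es → Σ (Fin n × Fin n) λ e → e ∈ es × (z ≡ proj₁ e ⊎ z ≡ proj₂ e)
  ∈-endpoints⁻ z∈ with e , e∈ , z∈e ← find (∈-concatMap⁻ _ z∈) = e , e∈ , end z∈e
    where
    end : ∀ {z x y} → z ∈ x ∷ y ∷ [] → z ≡ x ⊎ z ≡ y
    end (here z≡x)         = inj₁ z≡x
    end (there (here z≡y)) = inj₂ z≡y

  edgesAt : Mates → List (Fin n) → List (Fin n × Fin n)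
  edgesAt M []       = []
  edgesAt M (x ∷ xs) = matchedAt M x ++ edgesAt M xs

  ∈-edgesAt⁻ : ∀ M {xs e} → e ∈ edgesAt M xs →
               proj₁ e ∈ xs × Left (proj₁ e) × mate M (proj₁ e) ≡ just (proj₂ e)
  ∈-edgesAt⁻ M {x ∷ xs} e∈ with side x in side-x | mate M x in x↦
  ... | true  | _       = map₁ there (∈-edgesAt⁻ M e∈)
  ... | false | nothing = map₁ there (∈-edgesAt⁻ M e∈)
  ... | false | just y with e∈
  ...   | here refl = here refl , side-x , x↦
  ...   | there e∈′ = map₁ there (∈-edgesAt⁻ M e∈′)

  ∈-edgesAt⁺ : ∀ M {xs x y} → x ∈ xs → Left x → mate M x ≡ just y → (x , y) ∈ edgesAt M xs
  ∈-edgesAt⁺ M (here refl) left-x x↦y rewrite left-x | x↦y = here refl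
  ∈-edgesAt⁺ M {x′ ∷ _} (there x∈) left-x x↦y = ∈-++⁺ʳ (matchedAt M x′) (∈-edgesAt⁺ M x∈ left-x x↦y)

  Unique-endpoints-edgesAt : ∀ M {xs} → Unique xs → Unique (endpoints (edgesAt M xs))
  Unique-endpoints-edgesAt M []                     = []
  Unique-endpoints-edgesAt M {x ∷ xs} (x≢xs ∷ unique) with side x in left-x | mate M x in x↦y
  ... | true  | _       = Unique-endpoints-edgesAt M unique
  ... | false | nothing = Unique-endpoints-edgesAt M unique
  ... | false | just y  = All.tabulate x≢ ∷ All.tabulate y≢ ∷ Unique-endpoints-edgesAt M unique
    where
    right-y : Right y
    right-y = left-~ left-x (mate-~ M x↦y)
    x≢ : ∀ {z} → z ∈ y ∷ endpoints (edgesAt M xs) → x ≢ z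
    x≢ (here refl) = left≢right left-x right-y
    x≢ (there z∈) with (x′ , y′) , e∈ , z≡ ← ∈-endpoints⁻ {es = edgesAt M xs} z∈
      with x′∈ , left-x′ , x′↦y′ ← ∈-edgesAt⁻ M {xs} e∈ | z≡
    ... | inj₁ refl = All.lookup x≢xs x′∈
    ... | inj₂ refl = left≢right left-x (left-~ left-x′ (mate-~ M x′↦y′))
    y≢ : ∀ {z} → z ∈ endpoints (edgesAt M xs) → y ≢ z
    y≢ z∈ with (x′ , y′) , e∈ , z≡ ← ∈-endpoints⁻ {es = edgesAt M xs} z∈
      with x′∈ , left-x′ , x′↦y′ ← ∈-edgesAt⁻ M {xs} e∈ | z≡
    ... | inj₁ refl = λ y≡x′ → left≢right left-x′ right-y (sym y≡x′)
    ... | inj₂ refl = λ { refl → All.lookup x≢xs x′∈ (mate-injective M x↦y x′↦y′) }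

  edges : Mates → List (Fin n × Fin n)
  edges M = edgesAt M (allFin n)

  edges-matching : ∀ M → IsMatching G (edges M)
  edges-matching M = All.tabulate (λ e∈ → mate-~ M (proj₂ (proj₂ (∈-edgesAt⁻ M {allFin n} e∈))))
                   , Unique-endpoints-edgesAt M (allFin⁺ n)

  -- König's cover: each matched edge contributes its right end if that was reached, else its left end.
  saturated⇒cover : ∀ M → Saturated M →
                    Σ (List (Fin n)) λ C → IsVertexCover G C × length C ≤ length (edges M)
  saturated⇒cover M sat = C , cover , ≤-reflexive (length-map choose (edges M))
    where
    open Saturated sat
    choose : Fin n × Fin n → Fin n
    choose (l , r) = if r ∈ᵇ reached then r else l
    C : List (Fin n)
    C = map choose (edges M)
    chosen : ∀ {l r} → Left l → mate M l ≡ just r → choose (l , r) ∈ C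
    chosen left-l l↦r = ∈-map⁺ choose (∈-edgesAt⁺ M (∈-allFin _) left-l l↦r)
    cover-from-left : ∀ {l r} → Left l → l ~ r → l ∈ C ⊎ r ∈ C
    cover-from-left {l} {r} left-l l~r with l ∈? reached | mate M l in l↦
    ... | no l∉ | nothing = ⊥-elim (l∉ (reached-closed (free left-l l↦)))
    ... | no l∉ | just r₀ = inj₁ (subst (_∈ C) (cong (if_then r₀ else l) r₀∉) (chosen left-l l↦))
      where
      r₀∉ : r₀ ∈ᵇ reached ≡ false
      r₀∉ = ∉⇒∈ᵇ λ r₀∈ → l∉ (reached-closed (via-mate r₀∈ (left-~ left-l (mate-~ M l↦)) (mate-sym M l↦)))
    ... | yes l∈ | _ with mate M r in r↦
    ...   | nothing = ⊥-elim (reached-matched r∈ right-r r↦)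
      where
      right-r = left-~ left-l l~r
      r∈ = reached-closed (via-edge l∈ left-l l~r)
    ...   | just l′ = inj₂ (subst (_∈ C) (cong (if_then r else l′) (∈⇒∈ᵇ r∈))
                                 (chosen (right-~ (left-~ left-l l~r) (mate-~ M r↦)) (mate-sym M r↦)))
      where r∈ = reached-closed (via-edge l∈ left-l l~r)
    cover : IsVertexCover G C
    cover {i} {j} i~j with side i in side-i
    ... | false = cover-from-left side-i i~j
    ... | true  = swap (cover-from-left (right-~ side-i i~j) (~-sym i~j))

  matching-cover : Σ (List (Fin n × Fin n)) λ M → IsMatching G M ×
                   Σ (List (Fin n)) λ C → IsVertexCover G C × length C ≤ length M
  matching-cover with M , sat ← saturate n unmatched (m≤n+m n (size unmatched)) =
    edges M , edges-matching M , saturated⇒cover M sat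

lemma2 : ∀ (n : ℕ) (G : Graph n) → IsBipartite G → (a : ℕ) → IsAnnihilationNumber G a →
    Σ (List (Fin n × Fin n)) λ M → IsMatching G M × n ∸ a ≤ length M
lemma2 n G (side , proper) a ann with M , matching , C , cover , C≤M ← König.matching-cover G side proper =
  M , matching , ≤-trans (n∸a≤vertexCover G ann cover) C≤M
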